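{- Let $n\ge 3$, let $G$ be a bipartite graph and $H$ a non-bipartite graph, both on $n$ vertices. Suppose there are $m\ge \frac{5n}{6}+2$ distinct vertices $v_1,\dots,v_m$ of $G$ and distinct vertices $w_1,\dots,w_m$ of $H$ with $G-v_i\cong H-w_i$ for all $i$. Then every cycle of even length in $H$ has at most $\frac{n}{3}-4$ vertices.
   Context: All graphs are finite and simple. For a graph $X$ and vertex $v$, $X-v$ denotes the graph obtained by deleting $v$ and its incident edges. -}

module Defs where

open import Data.Nat using (ℕ; zero; suc; _+_; _*_; _≤_)
open import Data.Nat.Divisibility using (_∣_)
open import Data.Bool using (Bool; true; false)
open import Data.Fin using (Fin; zero; suc; punchIn; toℕ; inject₁; fromℕ)
open import Data.Fin.Properties using ()
open import Data.Product using (Σ; ∃; _×_; _,_)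
open import Function.Bundles using (_↔_; Inverse)
open import Function.Definitions using (Injective)
open import Relation.Binary.PropositionalEquality using (_≡_; _≢_)

record Graph (n : ℕ) : Set where
  field
    adj   : Fin n → Fin n → Bool
    sym   : ∀ x y → adj x y ≡ adj y x
    irrefl : ∀ x → adj x x ≡ false
open Graph public

Adjacent : ∀ {n} → Graph n → Fin n → Fin n → Set
Adjacent G x y = adj G x y ≡ true

deleteVertex : ∀ {k} → Graph (suc k) → Fin (suc k) → Graph k
deleteVertex G v = record
  { adj    = λ x y → adj G (punchIn v x) (punchIn v y)
  ; sym    = λ x y → sym G (punchIn v x) (punchIn v y)
  ; irrefl = λ x → irrefl G (punchIn v x)
  }

record _≅_ {n : ℕ} (G H : Graph n) : Set where
  field
    bij      : Fin n ↔ Fin n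
    preserve : ∀ x y → adj H (Inverse.to bij x) (Inverse.to bij y) ≡ adj G x y

Bipartite : ∀ {n} → Graph n → Set
Bipartite {n} G = Σ (Fin n → Bool) λ c → ∀ x y → Adjacent G x y → c x ≢ c y

record Cycle {n : ℕ} (G : Graph n) (ℓ : ℕ) : Set where
  field
    three≤ℓ : 3 ≤ ℓ
    k       : ℕ
    ℓ≡      : ℓ ≡ suc k
    vert    : Fin (suc k) → Fin n
    inj     : Injective _≡_ _≡_ vert
    step    : ∀ (i : Fin k) → Adjacent G (vert (inject₁ i)) (vert (suc i))
    close   : Adjacent G (vert (fromℕ k)) (vert zero)

{-# OPTIONS --safe #-}
-- Each w_i with G - v_i ≅ H - w_i yields a proper 2-colouring κ of H - w_i.  Counting
-- vertices, a long even cycle C of H contains three such vertices a, b, c.  An arc of C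
-- avoiding one of them, say c, changes κ_c by the parity of its length, so the parity φ
-- of the position on C is a potential: for any two of a, b, c, the colouring of H minus
-- the third sees their colours differ by the difference of their φ-values (for the pair
-- that needs the arc through the closing edge, because C is even).  Then the colour
-- κ_u x, corrected by the potential of the last special vertex reached, assigns every
-- vertex in the component of a a colour consistent along edges, while κ_a colours the
-- rest; so H would be bipartite.
module Submission where

open import Defs hiding (sym)
open import Data.Bool using (Bool; true; false; not; _xor_)
open import Data.Bool.Properties using (not-¬; ¬-not; not-injective; not-involutive; xor-annihilates-not)
open import Data.Empty using (⊥-elim)
open import Data.Fin using (Fin; zero; suc; toℕ; punchIn; punchOut; inject₁; fromℕ; fromℕ<) renaming (_<_ to _<ᶠ_)
open import Data.Fin.Properties
  using (_≟_; any?; ¬Fin0; 0≢1+n; suc-injective; toℕ-injective; toℕ<n; toℕ-fromℕ<; toℕ-fromℕ; toℕ-inject₁;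
         punchInᵢ≢i; punchIn-punchOut; punchOut-injective; injective⇒≤; <-cmp)
  renaming (<-irrefl to <ᶠ-irrefl)
open import Data.Nat using (ℕ; zero; suc; _+_; _*_; _≤_; _<_; _≤′_; ≤′-reflexive; ≤′-step; _≤?_; z≤n; s≤s)
open import Data.Nat.Properties
  using (≤-refl; ≤-trans; <⇒≤; <⇒≱; ≰⇒>; ≤-pred; n≤1+n; m≤n⇒m≤1+n; m<m+n; +-suc; +-mono-≤; *-monoʳ-≤;
         <-irrefl; <-≤-trans; ≤-<-trans; m≤n⇒m<n∨m≡n; ≤⇒≤′; ≤′⇒≤)
open import Data.Nat.DivMod using (_mod_; _%_; m<n⇒m%n≡m; n%n≡0)
open import Data.Nat.Divisibility using (_∣_; divides)
open import Data.Nat.Tactic.RingSolver using (solve-∀)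
open import Data.Product using (Σ; ∃; _×_; _,_; proj₁; proj₂)
open import Data.Sum using (inj₁; inj₂)
open import Data.Vec.Functional using (_∷_)
open import Function using (_∘_)
open import Function.Bundles using (Inverse)
open import Function.Definitions using (Injective)
open import Relation.Binary using (_Preserves_⟶_; tri<; tri≈; tri>)
open import Relation.Binary.PropositionalEquality using (_≡_; _≢_; refl; sym; trans; cong; cong₂; subst; subst₂; module ≡-Reasoning)
open import Relation.Nullary using (¬_; Dec; yes; no)
open import Relation.Nullary.Decidable using (¬¬-excluded-middle)

open ≡-Reasoning

odd : ℕ → Bool
odd zero    = false
odd (suc n) = not (odd n)

odd-*2 : ∀ q → odd (q * 2) ≡ false
odd-*2 zero    = refl
odd-*2 (suc q) = trans (not-involutive _) (odd-*2 q)

2∣⇒odd≡false : ∀ {ℓ} → 2 ∣ ℓ → odd ℓ ≡ false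
2∣⇒odd≡false (divides q refl) = odd-*2 q

even≥3⇒≥4 : ∀ ℓ → 3 ≤ ℓ → odd ℓ ≡ false → 4 ≤ ℓ
even≥3⇒≥4 zero                      ()                  _
even≥3⇒≥4 (suc zero)                (s≤s ())            _
even≥3⇒≥4 (suc (suc zero))          (s≤s (s≤s ()))      _
even≥3⇒≥4 (suc (suc (suc zero)))    _                   ()
even≥3⇒≥4 (suc (suc (suc (suc _)))) _ _ = s≤s (s≤s (s≤s (s≤s z≤n)))

xor-cancelˡ : ∀ a {b c} → a xor b ≡ a xor c → b ≡ c
xor-cancelˡ false eq = eq
xor-cancelˡ true  eq = not-injective eq

¬¬-decide-all : ∀ {n} (P : Fin n → Set) → ¬ ¬ (∀ x → Dec (P x))
¬¬-decide-all {zero}  P k = k λ ()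
¬¬-decide-all {suc n} P k =
  ¬¬-excluded-middle λ d₀ → ¬¬-decide-all (P ∘ suc) λ d → k λ { zero → d₀ ; (suc x) → d x }

increasing⇒injective : ∀ {a b} {f : Fin a → Fin b} → f Preserves _<ᶠ_ ⟶ _<ᶠ_ → Injective _≡_ _≡_ f
increasing⇒injective {f = f} increasing {i} {j} fi≡fj with <-cmp i j
... | tri< i<j _ _ = ⊥-elim (<ᶠ-irrefl fi≡fj (increasing i<j))
... | tri≈ _ i≡j _ = i≡j
... | tri> _ _ j<i = ⊥-elim (<ᶠ-irrefl (sym fi≡fj) (increasing j<i))

CommonValues : ∀ {a m n} → ℕ → (Fin a → Fin n) → (Fin m → Fin n) → Set
CommonValues {a} c f h = Σ (Fin c → Fin a) λ pos → pos Preserves _<ᶠ_ ⟶ _<ᶠ_ × (∀ j → ∃ λ i → h i ≡ f (pos j))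

many-common-values : ∀ {a m n} c (f : Fin a → Fin n) (h : Fin m → Fin n) → Injective _≡_ _≡_ f → Injective _≡_ _≡_ h
  → n + c ≤ a + m → CommonValues c f h
many-common-values zero f h _ _ _ = (λ ()) , (λ { {()} }) , λ ()
many-common-values {zero} {m} {n} (suc c) f h _ h-inj bound =
  ⊥-elim (<⇒≱ (m<m+n n (s≤s z≤n)) (≤-trans bound (injective⇒≤ h-inj)))
many-common-values {suc a} {m} {zero} (suc c) f h _ _ _ = ⊥-elim (¬Fin0 (f zero))
many-common-values {suc a} {m} {suc n} (suc c) f h f-inj h-inj bound with any? (λ i → h i ≟ f zero)
... | yes hit₀ = extend (many-common-values c (f ∘ suc) h (suc-injective ∘ f-inj) h-inj
                                          (≤-pred (subst (_≤ suc a + m) (+-suc (suc n) c) bound)))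
  where
  extend : CommonValues c (f ∘ suc) h → CommonValues (suc c) f h
  extend (pos , pos-increasing , hits) = zero ∷ (suc ∘ pos) , increasing , λ { zero → hit₀ ; (suc j) → hits j }
    where
    increasing : (zero ∷ (suc ∘ pos)) Preserves _<ᶠ_ ⟶ _<ᶠ_
    increasing {zero}  {suc _} _         = s≤s z≤n
    increasing {suc _} {suc _} (s≤s i<j) = s≤s (pos-increasing i<j)
... | no miss = lift (many-common-values (suc c) f′ h′ f′-inj h′-inj (≤-pred bound))
  where
  f₀≢f : ∀ j → f zero ≢ f (suc j)
  f₀≢f j eq = 0≢1+n (f-inj eq)
  f₀≢h : ∀ i → f zero ≢ h i
  f₀≢h i eq = miss (i , sym eq)
  f′ : Fin a → Fin n
  f′ j = punchOut (f₀≢f j)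
  h′ : Fin m → Fin n
  h′ i = punchOut (f₀≢h i)
  f′-inj : Injective _≡_ _≡_ f′
  f′-inj eq = suc-injective (f-inj (punchOut-injective (f₀≢f _) (f₀≢f _) eq))
  h′-inj : Injective _≡_ _≡_ h′
  h′-inj eq = h-inj (punchOut-injective (f₀≢h _) (f₀≢h _) eq)
  lift : CommonValues (suc c) f′ h′ → CommonValues (suc c) f h
  lift (pos , pos-increasing , hits) = suc ∘ pos , (λ i<j → s≤s (pos-increasing i<j)) ,
    λ j → let (i , eq) = hits j in i , punchOut-injective (f₀≢h i) (f₀≢f (pos j)) eq

-- Adding six times the negated conclusion, both hypotheses and 3 * 4 ≤ 3 * ℓ gives X + 1 ≤ X.
overlap-bound : ∀ {ℓ m n} → 4 ≤ ℓ → 5 * n + 12 ≤ 6 * m → n < 3 * (ℓ + 4) → n + 3 ≤ ℓ + m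
overlap-bound {ℓ} {m} {n} 4≤ℓ size n< with n + 3 ≤? ℓ + m
... | yes enough = enough
... | no ¬enough = ⊥-elim (<-irrefl refl (subst (_≤ 6 * (n + 3) + 6 * m + 3 * (ℓ + 4) + 3 * ℓ) (sum≡ ℓ m n) total))
  where
  total : 6 * suc (ℓ + m) + (5 * n + 12) + suc n + 3 * 4 ≤ 6 * (n + 3) + 6 * m + 3 * (ℓ + 4) + 3 * ℓ
  total = +-mono-≤ (+-mono-≤ (+-mono-≤ (*-monoʳ-≤ 6 (≰⇒> ¬enough)) size) n<) (*-monoʳ-≤ 3 4≤ℓ)
  sum≡ : ∀ ℓ m n → 6 * suc (ℓ + m) + (5 * n + 12) + suc n + 3 * 4 ≡ suc (6 * (n + 3) + 6 * m + 3 * (ℓ + 4) + 3 * ℓ)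
  sum≡ = solve-∀

Adjacent-sym : ∀ {n} (H : Graph n) {x y} → Adjacent H x y → Adjacent H y x
Adjacent-sym H {x} {y} = trans (Graph.sym H y x)

ProperExcept : ∀ {n} → Graph n → Fin n → (Fin n → Bool) → Set
ProperExcept H u κ = ∀ x y → x ≢ u → y ≢ u → Adjacent H x y → κ x ≢ κ y

properExcept-xor : ∀ {n} {H : Graph n} {u κ x y} → ProperExcept H u κ → x ≢ u → y ≢ u → Adjacent H x y
  → ∀ β → κ y xor not β ≡ κ x xor β
properExcept-xor {H = H} {κ = κ} {x = x} {y = y} proper x≢u y≢u e β = begin
  κ y xor not β       ≡⟨ cong (_xor not β) (¬-not (proper y x y≢u x≢u (Adjacent-sym H e))) ⟩
  not (κ x) xor not β ≡⟨ xor-annihilates-not (κ x) β ⟩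
  κ x xor β           ∎

bipartite-deleteVertex : ∀ {k} {G : Graph (suc k)} v → Bipartite G → Bipartite (deleteVertex G v)
bipartite-deleteVertex v (c , proper) = c ∘ punchIn v , λ x y → proper (punchIn v x) (punchIn v y)

bipartite-≅ : ∀ {n} {G H : Graph n} → G ≅ H → Bipartite G → Bipartite H
bipartite-≅ {G = G} {H} iso (c , proper) = c ∘ from , λ x y e → proper (from x) (from y) (begin
  adj G (from x) (from y)             ≡⟨ sym (preserve (from x) (from y)) ⟩
  adj H (to (from x)) (to (from y))   ≡⟨ cong₂ (adj H) (strictlyInverseˡ x) (strictlyInverseˡ y) ⟩
  adj H x y                           ≡⟨ e ⟩
  true                                ∎)
  where
  open _≅_ iso
  open Inverse bij

properExcept-deleteVertex : ∀ {k} {H : Graph (suc k)} w → Bipartite (deleteVertex H w) → ∃ (ProperExcept H w)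
properExcept-deleteVertex {k} {H} w (c , proper) = κ , κ-proper
  where
  κ : Fin (suc k) → Bool
  κ x with w ≟ x
  ... | yes _   = false
  ... | no w≢x = c (punchOut w≢x)
  κ-proper : ProperExcept H w κ
  κ-proper x y x≢w y≢w e with w ≟ x | w ≟ y
  ... | yes w≡x | _       = ⊥-elim (x≢w (sym w≡x))
  ... | no _    | yes w≡y = ⊥-elim (y≢w (sym w≡y))
  ... | no w≢x  | no w≢y  =
    proper _ _ (trans (cong₂ (adj H) (punchIn-punchOut w≢x) (punchIn-punchOut w≢y)) e)

-- Phase 2-colours the component of a, and κ the rest of H.  Which vertices carry a
-- phase is not decidable constructively, hence the double negation.
¬¬bipartite-from-phase : ∀ {n} (H : Graph n) (Phase : Fin n → Bool → Set)
  → (∀ {x y β} → Phase x β → Adjacent H x y → Phase y (not β))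
  → (∀ {x β β′} → Phase x β → Phase x β′ → β ≡ β′)
  → ∀ {a β κ} → Phase a β → ProperExcept H a κ → ¬ ¬ Bipartite H
¬¬bipartite-from-phase {n} H Phase step functional {a} {β₀} {κ} phase-a κ-proper ¬bipartite =
  ¬¬-decide-all (λ x → ∃ (Phase x)) λ decide → ¬bipartite (colour decide , proper decide)
  where
  colour : (∀ x → Dec (∃ (Phase x))) → Fin n → Bool
  colour decide x with decide x
  ... | yes (β , _) = β
  ... | no _        = κ x
  outside : ∀ {x} → ¬ ∃ (Phase x) → x ≢ a
  outside ¬phase refl = ¬phase (β₀ , phase-a)
  proper : ∀ decide x y → Adjacent H x y → colour decide x ≢ colour decide y
  proper decide x y e with decide x | decide y
  ... | yes (β , px) | yes (β′ , py) = λ β≡β′ → not-¬ (sym β≡β′) (functional py (step px e))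
  ... | yes (β , px) | no ¬py        = ⊥-elim (¬py (not β , step px e))
  ... | no ¬px       | yes (β′ , py) = ⊥-elim (¬px (not β′ , step py (Adjacent-sym H e)))
  ... | no ¬px       | no ¬py        = κ-proper x y (outside ¬px) (outside ¬py) e

-- φ is a potential on the special vertices, as seen by the colouring of H minus a third one.
Separated : ∀ {n s} → (Fin s → Fin n) → (Fin s → Fin n → Bool) → (Fin s → Bool) → Set
Separated sp κ φ = ∀ t s → t ≢ s → ∃ λ w → w ≢ t × w ≢ s × κ w (sp t) xor φ t ≡ κ w (sp s) xor φ s

module SeparatedDeletions {n c} (H : Graph n) (sp : Fin (2 + c) → Fin n) (sp-injective : Injective _≡_ _≡_ sp)
  (κ : Fin (2 + c) → Fin n → Bool) (κ-proper : ∀ t → ProperExcept H (sp t) (κ t))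
  (φ : Fin (2 + c) → Bool) (separated : Separated sp κ φ) where

  InZone : Fin (2 + c) → Fin n → Set
  InZone t x = ∀ u → u ≢ t → x ≢ sp u

  -- β is the colour of x predicted from sp t and its potential φ t by every colouring
  -- κ u that is defined on the whole zone of t.
  Phase : Fin n → Bool → Set
  Phase x β = ∃ λ t → InZone t x × (∀ u → u ≢ t → κ u x xor β ≡ κ u (sp t) xor φ t)

  special-in-zone : ∀ t → InZone t (sp t)
  special-in-zone t u u≢t sp-t≡sp-u = u≢t (sp-injective (sym sp-t≡sp-u))

  phase-special : ∀ t → Phase (sp t) (φ t)
  phase-special t = t , special-in-zone t , λ _ _ → refl

  phase-functional : ∀ {x β β′} → Phase x β → Phase x β′ → β ≡ β′
  phase-functional {x} (t , _ , eq) (t′ , _ , eq′) with t ≟ t′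
  ... | yes refl = xor-cancelˡ (κ u x) (trans (eq u u≢t) (sym (eq′ u u≢t)))
    where
    u : Fin (2 + c)
    u = punchIn t zero
    u≢t : u ≢ t
    u≢t = punchInᵢ≢i t zero
  ... | no t≢t′ with separated t t′ t≢t′
  ...   | w , w≢t , w≢t′ , sep = xor-cancelˡ (κ w x) (trans (eq w w≢t) (trans sep (sym (eq′ w w≢t′))))

  phase-step-in-zone : ∀ {t x y β} → InZone t x → InZone t y → Adjacent H x y
    → (∀ u → u ≢ t → κ u x xor β ≡ κ u (sp t) xor φ t) → Phase y (not β)
  phase-step-in-zone {t} {β = β} x∈t y∈t e eq =
    t , y∈t , λ u u≢t → trans (properExcept-xor {H = H} (κ-proper u) (x∈t u u≢t) (y∈t u u≢t) e β) (eq u u≢t)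

  phase-step : ∀ {x y β} → Phase x β → Adjacent H x y → Phase y (not β)
  phase-step {x} {y} {β} (t , x∈t , eq) e with any? (λ s → y ≟ sp s)
  ... | no ordinary = phase-step-in-zone x∈t (λ u _ y≡sp-u → ordinary (u , y≡sp-u)) e eq
  ... | yes (s , refl) with t ≟ s
  ...   | yes refl = phase-step-in-zone x∈t (special-in-zone t) e eq
  ...   | no t≢s with separated t s t≢s
  ...     | w , w≢t , w≢s , sep = subst (Phase (sp s)) (sym arrival) (phase-special s)
    where
    arrival : not β ≡ φ s
    arrival = xor-cancelˡ (κ w (sp s)) (begin
      κ w (sp s) xor not β ≡⟨ properExcept-xor {H = H} (κ-proper w) (x∈t w w≢t) (special-in-zone s w w≢s) e β ⟩
      κ w x xor β          ≡⟨ eq w w≢t ⟩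
      κ w (sp t) xor φ t   ≡⟨ sep ⟩
      κ w (sp s) xor φ s   ∎)

  ¬¬bipartite : ¬ ¬ Bipartite H
  ¬¬bipartite = ¬¬bipartite-from-phase H Phase phase-step phase-functional (phase-special zero) (κ-proper zero)

module CyclePositions {n ℓ} {H : Graph n} (cyc : Cycle H ℓ) where
  open Cycle cyc using (k; vert; inj; step; close)

  at : ℕ → Fin n
  at r = vert (r mod suc k)

  vert≡at : ∀ {i} r → toℕ i ≡ r % suc k → vert i ≡ at r
  vert≡at _ eq = cong vert (toℕ-injective (trans eq (sym (toℕ-fromℕ< _))))

  at-toℕ : ∀ i → at (toℕ i) ≡ vert i
  at-toℕ i = sym (vert≡at (toℕ i) (sym (m<n⇒m%n≡m (toℕ<n i))))

  at-wrap : at (suc k) ≡ at 0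
  at-wrap = sym (vert≡at (suc k) (sym (n%n≡0 (suc k))))

  at-injective : ∀ {r r′} → r < suc k → r′ < suc k → at r ≡ at r′ → r ≡ r′
  at-injective {r} {r′} r< r′< at-r≡at-r′ = begin
    r                          ≡⟨ sym (m<n⇒m%n≡m r<) ⟩
    r % suc k                  ≡⟨ sym (toℕ-fromℕ< _) ⟩
    toℕ (r mod suc k)          ≡⟨ cong toℕ (inj at-r≡at-r′) ⟩
    toℕ (r′ mod suc k)         ≡⟨ toℕ-fromℕ< _ ⟩
    r′ % suc k                 ≡⟨ m<n⇒m%n≡m r′< ⟩
    r′                         ∎

  at-≢ : ∀ {r r′} → r < suc k → r′ < suc k → r ≢ r′ → at r ≢ at r′
  at-≢ r< r′< r≢r′ = r≢r′ ∘ at-injective r< r′<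

  at-step : ∀ {r} → r < suc k → Adjacent H (at r) (at (suc r))
  at-step {r} (s≤s r≤k) with m≤n⇒m<n∨m≡n r≤k
  ... | inj₁ r<k = subst₂ (Adjacent H) (vert≡at r inject₁-pos) (vert≡at (suc r) suc-pos) (step (fromℕ< r<k))
    where
    inject₁-pos : toℕ (inject₁ (fromℕ< r<k)) ≡ r % suc k
    inject₁-pos = trans (toℕ-inject₁ _) (trans (toℕ-fromℕ< r<k) (sym (m<n⇒m%n≡m (s≤s (<⇒≤ r<k)))))
    suc-pos : suc (toℕ (fromℕ< r<k)) ≡ suc r % suc k
    suc-pos = trans (cong suc (toℕ-fromℕ< r<k)) (sym (m<n⇒m%n≡m (s≤s r<k)))
  ... | inj₂ refl = subst₂ (Adjacent H) (vert≡at k last-pos) (vert≡at (suc k) (sym (n%n≡0 (suc k)))) close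
    where
    last-pos : toℕ (fromℕ k) ≡ k % suc k
    last-pos = trans (toℕ-fromℕ k) (sym (m<n⇒m%n≡m ≤-refl))

  -- Along an arc avoiding u, both κ and the parity of the position flip at every step.
  arc : ∀ {u κ} → ProperExcept H u κ → ∀ {p q} → p ≤ q → q ≤ suc k → (∀ r → p ≤ r → r ≤ q → at r ≢ u)
    → κ (at p) xor odd p ≡ κ (at q) xor odd q
  arc {u} {κ} proper {p} p≤q = arc′ (≤⇒≤′ p≤q)
    where
    arc′ : ∀ {q} → p ≤′ q → q ≤ suc k → (∀ r → p ≤ r → r ≤ q → at r ≢ u)
      → κ (at p) xor odd p ≡ κ (at q) xor odd q
    arc′ (≤′-reflexive refl) _ _ = refl
    arc′ {suc q} (≤′-step p≤′q) q<ℓ avoid = trans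
      (arc′ p≤′q (<⇒≤ q<ℓ) (λ r p≤r r≤q → avoid r p≤r (m≤n⇒m≤1+n r≤q)))
      (sym (properExcept-xor {H = H} proper (avoid q p≤q′ (n≤1+n q)) (avoid (suc q) (m≤n⇒m≤1+n p≤q′) ≤-refl)
                                      (at-step q<ℓ) (odd q)))
      where
      p≤q′ : p ≤ q
      p≤q′ = ≤′⇒≤ p≤′q

  arc-around : ∀ {u κ} → odd (suc k) ≡ false → ProperExcept H u κ → ∀ {p s} → p ≤ suc k → s ≤ suc k
    → (∀ r → s ≤ r → r < suc k → at r ≢ u) → (∀ r → r ≤ p → at r ≢ u)
    → κ (at s) xor odd s ≡ κ (at p) xor odd p
  arc-around {u} {κ} even proper {p} {s} p≤ℓ s≤ℓ avoid-end avoid-start = begin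
    κ (at s) xor odd s              ≡⟨ arc proper s≤ℓ ≤-refl avoid-wrap ⟩
    κ (at (suc k)) xor odd (suc k)  ≡⟨ cong₂ _xor_ (cong κ at-wrap) even ⟩
    κ (at 0) xor odd 0              ≡⟨ arc proper z≤n p≤ℓ (λ r _ → avoid-start r) ⟩
    κ (at p) xor odd p              ∎
    where
    avoid-wrap : ∀ r → s ≤ r → r ≤ suc k → at r ≢ u
    avoid-wrap r s≤r r≤ℓ with m≤n⇒m<n∨m≡n r≤ℓ
    ... | inj₁ r<ℓ  = avoid-end r s≤r r<ℓ
    ... | inj₂ refl = subst (_≢ u) (sym at-wrap) (avoid-start 0 z≤n)

  separated-on-even-cycle : odd (suc k) ≡ false → (P : Fin 3 → ℕ)
    → P zero < P (suc zero) → P (suc zero) < P (suc (suc zero)) → P (suc (suc zero)) < suc k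
    → (κ : Fin 3 → Fin n → Bool) → (∀ t → ProperExcept H (at (P t)) (κ t)) → Separated (at ∘ P) κ (odd ∘ P)
  separated-on-even-cycle even P p<q q<s s<ℓ κ κ-proper = separated
    where
    p q s : ℕ
    p = P zero
    q = P (suc zero)
    s = P (suc (suc zero))
    q<ℓ : q < suc k
    q<ℓ = <-≤-trans q<s (<⇒≤ s<ℓ)
    p<ℓ : p < suc k
    p<ℓ = <-≤-trans p<q (<⇒≤ q<ℓ)
    arc-pq : κ (suc (suc zero)) (at p) xor odd p ≡ κ (suc (suc zero)) (at q) xor odd q
    arc-pq = arc (κ-proper (suc (suc zero))) (<⇒≤ p<q) (<⇒≤ q<ℓ)
      λ r _ r≤q → at-≢ (≤-<-trans r≤q q<ℓ) s<ℓ λ { refl → <-irrefl refl (≤-<-trans r≤q q<s) }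
    arc-qs : κ zero (at q) xor odd q ≡ κ zero (at s) xor odd s
    arc-qs = arc (κ-proper zero) (<⇒≤ q<s) (<⇒≤ s<ℓ)
      λ r q≤r r≤s → at-≢ (≤-<-trans r≤s s<ℓ) p<ℓ λ { refl → <-irrefl refl (<-≤-trans p<q q≤r) }
    arc-sp : κ (suc zero) (at s) xor odd s ≡ κ (suc zero) (at p) xor odd p
    arc-sp = arc-around even (κ-proper (suc zero)) (<⇒≤ p<ℓ) (<⇒≤ s<ℓ)
      (λ r s≤r r<ℓ → at-≢ r<ℓ q<ℓ λ { refl → <-irrefl refl (<-≤-trans q<s s≤r) })
      (λ r r≤p → at-≢ (≤-<-trans r≤p p<ℓ) q<ℓ λ { refl → <-irrefl refl (≤-<-trans r≤p p<q) })
    separated : Separated (at ∘ P) κ (odd ∘ P)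
    separated zero             (suc zero)       _ = suc (suc zero) , (λ ()) , (λ ()) , arc-pq
    separated (suc zero)       zero             _ = suc (suc zero) , (λ ()) , (λ ()) , sym arc-pq
    separated (suc zero)       (suc (suc zero)) _ = zero , (λ ()) , (λ ()) , arc-qs
    separated (suc (suc zero)) (suc zero)       _ = zero , (λ ()) , (λ ()) , sym arc-qs
    separated (suc (suc zero)) zero             _ = suc zero , (λ ()) , (λ ()) , arc-sp
    separated zero             (suc (suc zero)) _ = suc zero , (λ ()) , (λ ()) , sym arc-sp
    separated zero             zero             t≢t = ⊥-elim (t≢t refl)
    separated (suc zero)       (suc zero)       t≢t = ⊥-elim (t≢t refl)
    separated (suc (suc zero)) (suc (suc zero)) t≢t = ⊥-elim (t≢t refl)

  ¬¬bipartite-three-deletions : odd (suc k) ≡ false → (pos : Fin 3 → Fin (suc k)) → pos Preserves _<ᶠ_ ⟶ _<ᶠ_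
    → (∀ t → ∃ (ProperExcept H (vert (pos t)))) → ¬ ¬ Bipartite H
  ¬¬bipartite-three-deletions even pos increasing colourings =
    SeparatedDeletions.¬¬bipartite H (at ∘ P) sp-injective κ κ-proper (odd ∘ P)
      (separated-on-even-cycle even P (increasing (s≤s z≤n)) (increasing (s≤s (s≤s z≤n))) (toℕ<n _) κ κ-proper)
    where
    P : Fin 3 → ℕ
    P = toℕ ∘ pos
    κ : Fin 3 → Fin n → Bool
    κ t = proj₁ (colourings t)
    κ-proper : ∀ t → ProperExcept H (at (P t)) (κ t)
    κ-proper t = subst (λ x → ProperExcept H x (κ t)) (sym (at-toℕ (pos t))) (proj₂ (colourings t))
    sp-injective : Injective _≡_ _≡_ (at ∘ P)
    sp-injective {t} {t′} eq =
      increasing⇒injective increasing (inj (trans (sym (at-toℕ (pos t))) (trans eq (at-toℕ (pos t′)))))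

deletion-colouring : ∀ {k} {G H : Graph (suc k)} v w → Bipartite G → deleteVertex G v ≅ deleteVertex H w
  → ∃ (ProperExcept H w)
deletion-colouring {G = G} {H} v w bipartite-G iso =
  properExcept-deleteVertex {H = H} w (bipartite-≅ iso (bipartite-deleteVertex {G = G} v bipartite-G))

corollary4 : (k : ℕ) → 3 ≤ suc k → (G H : Graph (suc k)) → Bipartite G → ¬ Bipartite H
    → (m : ℕ) → 5 * suc k + 12 ≤ 6 * m
    → (v w : Fin m → Fin (suc k)) → Injective _≡_ _≡_ v → Injective _≡_ _≡_ w
    → (∀ i → deleteVertex G (v i) ≅ deleteVertex H (w i))
    → ∀ ℓ → 2 ∣ ℓ → Cycle H ℓ → 3 * (ℓ + 4) ≤ suc k
corollary4 k _ G H bipartite-G ¬bipartite-H m size v w _ w-inj iso ℓ 2∣ℓ cyc with 3 * (ℓ + 4) ≤? suc k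
... | yes short = short
... | no long with many-common-values 3 (Cycle.vert cyc) w (Cycle.inj cyc) w-inj enough
  where
  enough : suc k + 3 ≤ suc (Cycle.k cyc) + m
  enough = subst (λ ℓ′ → suc k + 3 ≤ ℓ′ + m) (Cycle.ℓ≡ cyc)
    (overlap-bound (even≥3⇒≥4 ℓ (Cycle.three≤ℓ cyc) (2∣⇒odd≡false 2∣ℓ)) size (≰⇒> long))
...   | pos , increasing , hits =
  ⊥-elim (CyclePositions.¬¬bipartite-three-deletions cyc even pos increasing colouring ¬bipartite-H)
  where
  even : odd (suc (Cycle.k cyc)) ≡ false
  even = subst (λ ℓ′ → odd ℓ′ ≡ false) (Cycle.ℓ≡ cyc) (2∣⇒odd≡false 2∣ℓ)
  colouring : ∀ t → ∃ (ProperExcept H (Cycle.vert cyc (pos t)))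
  colouring t = let (i , w-i≡) = hits t in
    subst (λ x → ∃ (ProperExcept H x)) w-i≡ (deletion-colouring {G = G} {H} (v i) (w i) bipartite-G (iso i))
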